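{- Let $\Gamma=\mathbb{Z}_2^d$ for an integer $d\ge4$. Then $\Gamma$ is not $(D(\Gamma)-1)$-close.
   Context: For a finite abelian group $\Gamma$, its Davenport constant $D(\Gamma)$ is the minimum integer such that every sequence of elements of $\Gamma$ of length $D(\Gamma)$ has a nonempty subsequence summing to $0$. For an integer $k\ge1$, a finite abelian group $\Gamma$ is $k$-close if for every matroid $M$, every labeling $\psi\colon E(M)\to\Gamma$, every $g\in\Gamma$ and every basis $B$ of $M$, whenever $M$ has a basis with label $g$ there exists a basis $B^*$ with $\psi(B^*)=g$ and $|B\setminus B^*|\le k$, where $\psi(X):=\sum_{e\in X}\psi(e)$. -}

module Defs where

open import Data.Nat using (ℕ; zero; suc; _≤_)
open import Data.Bool using (Bool; true; false; if_then_else_; _xor_)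
open import Data.Fin using (Fin; zero; suc)
open import Data.Fin.Subset using (Subset; _∈_; _∉_; _∪_; _─_; _-_; ⁅_⁆; ∣_∣; Nonempty)
open import Data.Vec using (Vec; []; _∷_; replicate; zipWith)
open import Data.Product using (Σ; ∃; _×_)
open import Relation.Binary.PropositionalEquality using (_≡_)
open import Function using (_∘_)

Z2^ : ℕ → Set
Z2^ d = Vec Bool d

0g : ∀ {d} → Z2^ d
0g = replicate _ false

infixl 6 _⊕_
_⊕_ : ∀ {d} → Z2^ d → Z2^ d → Z2^ d
_⊕_ = zipWith _xor_

label : ∀ {d m} → (Fin m → Z2^ d) → Subset m → Z2^ d
label ψ []      = 0g
label ψ (b ∷ S) = (if b then ψ zero else 0g) ⊕ label (ψ ∘ suc) S

ZeroSumProperty : ℕ → ℕ → Set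
ZeroSumProperty d n =
  (s : Fin n → Z2^ d) → Σ (Subset n) λ S → Nonempty S × label s S ≡ 0g

IsDavenportConstant : ℕ → ℕ → Set
IsDavenportConstant d D =
  ZeroSumProperty d D × ((n : ℕ) → ZeroSumProperty d n → D ≤ n)

record Matroid (m : ℕ) : Set₁ where
  field
    IsBasis  : Subset m → Set
    nonempty : ∃ IsBasis
    exchange : ∀ B₁ B₂ → IsBasis B₁ → IsBasis B₂ →
               ∀ x → x ∈ B₁ → x ∉ B₂ →
               ∃ λ y → y ∈ B₂ × y ∉ B₁ × IsBasis ((B₁ - x) ∪ ⁅ y ⁆)

open Matroid public

IsClose : ℕ → ℕ → Set₁
IsClose d k =
  ∀ (m : ℕ) (M : Matroid m) (ψ : Fin m → Z2^ d) (g : Z2^ d) (B : Subset m) →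
  IsBasis M B →
  (Σ (Subset m) λ B′ → IsBasis M B′ × label ψ B′ ≡ g) →
  Σ (Subset m) λ B* → IsBasis M B* × label ψ B* ≡ g × ∣ B ─ B* ∣ ≤ k

-- Any d + 1 elements of Z₂^d have a nonempty zero-sum subset (pigeonhole on the
-- 2^(d+1) subset sums), so D ≤ d + 1 and it suffices to show that Z₂^d is not
-- d-close. For d ≥ 4 there is an injective labelling ψ of a ground set of size
-- 2(d + 1) together with a partition of it into halves B and B* of different
-- labels. The (d + 1)-sets whose label differs from ψ(B*), together with B*
-- itself, are the bases of a (sparse paving) matroid: since ψ is injective, no
-- single exchange turns one set with the label of B* into another, which is all
-- the exchange axiom needs. In this matroid B* is the only basis with its label,
-- and it is d + 1 exchanges away from B. (For d = 3 the ground set would be all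
-- of Z₂³, whose halves always have equal labels.)
module Submission where

open import Defs
open import Level using (0ℓ)
open import Algebra.Bundles using (AbelianGroup)
open import Algebra.Structures using (IsAbelianGroup)
import Algebra.Properties.AbelianGroup as AbelianGroupProperties
import Algebra.Properties.CommutativeSemigroup as CommutativeSemigroupProperties
open import Data.Bool using (Bool; true; false; _xor_; if_then_else_)
open import Data.Bool.Properties
  using (xor-assoc; xor-comm; xor-identityˡ; xor-identityʳ; xor-same; ∨-identityʳ)
  renaming (_≟_ to _≟ᵇ_)
open import Data.Fin using (Fin; zero; suc; combine; remQuot)
open import Data.Fin.Properties
  using (2↔Bool; any?; all?; pigeonhole; <⇒≢; remQuot-combine; combine-remQuot)
  renaming (_≟_ to _≟ᶠ_)
open import Data.Fin.Subset
  using (Subset; _∈_; _∉_; _∪_; _─_; _-_; _⊆_; ⁅_⁆; ⊥; ∣_∣; Nonempty)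
open import Data.Fin.Subset.Properties
  using ( _∈?_; nonempty?; Empty-unique; drop-∷-⊆; p⊆q⇒∣p∣≤∣q∣; p─⊥≡p; ∪-identityʳ
        ; p─q⊆p; x∈⁅x⁆; x∈p∪q⁺; x∈p∧x≢y⇒x∈p-y; x∈p⇒∣p-x∣<∣p∣)
open import Data.Nat using (ℕ; zero; suc; _+_; _^_; _≤_; _<_; _∸_; z≤n; s≤s)
open import Data.Nat.Properties
  using (≤-trans; ≤-reflexive; <⇒≱; n<1+n; suc-injective; ∸-monoˡ-≤; ^-monoʳ-<)
open import Data.Product using (∃; _×_; _,_; proj₁; proj₂)
open import Data.Sum using (_⊎_; inj₁; inj₂)
open import Data.Vec using (Vec; []; _∷_; lookup; here; there)
open import Data.Vec.Properties
  using (zipWith-assoc; zipWith-comm; zipWith-identityˡ; zipWith-identityʳ; ∷-injectiveʳ; ≡-dec)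
open import Function using (_∘_; id; Inverse)
open import Function.Definitions using (Injective)
open import Relation.Binary.Definitions using (DecidableEquality)
open import Relation.Nullary using (¬_; yes; no; contradiction)
open import Relation.Nullary.Decidable using (_×-dec_; _→-dec_; ¬?; toWitness; decidable-stable)
open import Relation.Binary.PropositionalEquality
open import Relation.Binary.PropositionalEquality.Algebra using (isMagma)

_≟ᵛ_ : ∀ {d} → DecidableEquality (Z2^ d)
_≟ᵛ_ = ≡-dec _≟ᵇ_

⊕-identityˡ : ∀ {d} (v : Z2^ d) → 0g ⊕ v ≡ v
⊕-identityˡ = zipWith-identityˡ xor-identityˡ

⊕-identityʳ : ∀ {d} (v : Z2^ d) → v ⊕ 0g ≡ v
⊕-identityʳ = zipWith-identityʳ xor-identityʳ

⊕-self : ∀ {d} (v : Z2^ d) → v ⊕ v ≡ 0g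
⊕-self []      = refl
⊕-self (b ∷ v) = cong₂ _∷_ (xor-same b) (⊕-self v)

⊕-isAbelianGroup : ∀ d → IsAbelianGroup _≡_ (_⊕_ {d}) 0g id
⊕-isAbelianGroup d = record
  { isGroup = record
    { isMonoid = record
      { isSemigroup = record { isMagma = isMagma _⊕_ ; assoc = zipWith-assoc xor-assoc }
      ; identity    = ⊕-identityˡ , ⊕-identityʳ
      }
    ; inverse = ⊕-self , ⊕-self
    ; ⁻¹-cong = cong id
    }
  ; comm = zipWith-comm xor-comm
  }

Z2^-abelianGroup : ℕ → AbelianGroup 0ℓ 0ℓ
Z2^-abelianGroup d = record { isAbelianGroup = ⊕-isAbelianGroup d }

module Z2^ {d : ℕ} where
  open AbelianGroupProperties (Z2^-abelianGroup d) public
    using (∙-cancelˡ; inverseˡ-unique)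
  open CommutativeSemigroupProperties (AbelianGroup.commutativeSemigroup (Z2^-abelianGroup d)) public
    using (interchange; x∙yz≈y∙xz)

label-⊕ : ∀ {d m} (ψ : Fin m → Z2^ d) (S T : Subset m) →
          label ψ (S ⊕ T) ≡ label ψ S ⊕ label ψ T
label-⊕ ψ []      []      = sym (⊕-self 0g)
label-⊕ ψ (a ∷ S) (b ∷ T) =
  trans (cong₂ _⊕_ (if-xor a b) (label-⊕ (ψ ∘ suc) S T)) (Z2^.interchange _ _ _ _)
  where
  if-xor : ∀ a b → (if a xor b then ψ zero else 0g)
                 ≡ (if a then ψ zero else 0g) ⊕ (if b then ψ zero else 0g)
  if-xor true  true  = sym (⊕-self (ψ zero))
  if-xor true  false = sym (⊕-identityʳ (ψ zero))
  if-xor false b     = sym (⊕-identityˡ _)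

label-⊥ : ∀ {d m} (ψ : Fin m → Z2^ d) → label ψ ⊥ ≡ 0g
label-⊥ {m = zero}  ψ = refl
label-⊥ {m = suc m} ψ = trans (⊕-identityˡ _) (label-⊥ (ψ ∘ suc))

label-⁅⁆ : ∀ {d m} (ψ : Fin m → Z2^ d) x → label ψ ⁅ x ⁆ ≡ ψ x
label-⁅⁆ ψ zero    = trans (cong (ψ zero ⊕_) (label-⊥ (ψ ∘ suc))) (⊕-identityʳ (ψ zero))
label-⁅⁆ ψ (suc x) = trans (⊕-identityˡ _) (label-⁅⁆ (ψ ∘ suc) x)

label-false∷ : ∀ {d m} (ψ : Fin m → Z2^ d) S → label (λ i → false ∷ ψ i) S ≡ false ∷ label ψ S
label-false∷ ψ []          = refl
label-false∷ ψ (true ∷ S)  = cong ((false ∷ ψ zero) ⊕_) (label-false∷ (ψ ∘ suc) S)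
label-false∷ ψ (false ∷ S) = cong (0g ⊕_) (label-false∷ (ψ ∘ suc) S)

-- On Subset m = Z2^ m, _⊕_ is symmetric difference.
x∈p⇒p-x≡p⊕⁅x⁆ : ∀ {m} {p : Subset m} {x} → x ∈ p → p - x ≡ p ⊕ ⁅ x ⁆
x∈p⇒p-x≡p⊕⁅x⁆ {p = true ∷ p} here        = cong (false ∷_) (trans (p─⊥≡p p) (sym (⊕-identityʳ p)))
x∈p⇒p-x≡p⊕⁅x⁆ {p = s ∷ p}    (there x∈p) = cong₂ _∷_ (sym (xor-identityʳ s)) (x∈p⇒p-x≡p⊕⁅x⁆ x∈p)

x∉p⇒p∪⁅x⁆≡p⊕⁅x⁆ : ∀ {m} {p : Subset m} {x} → x ∉ p → p ∪ ⁅ x ⁆ ≡ p ⊕ ⁅ x ⁆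
x∉p⇒p∪⁅x⁆≡p⊕⁅x⁆ {p = true ∷ p}  {zero}  x∉p = contradiction here x∉p
x∉p⇒p∪⁅x⁆≡p⊕⁅x⁆ {p = false ∷ p} {zero}  _   = cong (true ∷_) (trans (∪-identityʳ p) (sym (⊕-identityʳ p)))
x∉p⇒p∪⁅x⁆≡p⊕⁅x⁆ {p = s ∷ p}     {suc x} x∉p =
  cong₂ _∷_ (trans (∨-identityʳ s) (sym (xor-identityʳ s))) (x∉p⇒p∪⁅x⁆≡p⊕⁅x⁆ (x∉p ∘ there))

x∈p⇒suc∣p-x∣≡∣p∣ : ∀ {m} {p : Subset m} {x} → x ∈ p → suc ∣ p - x ∣ ≡ ∣ p ∣
x∈p⇒suc∣p-x∣≡∣p∣ {p = true ∷ p}  here        = cong (suc ∘ ∣_∣) (p─⊥≡p p)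
x∈p⇒suc∣p-x∣≡∣p∣ {p = true ∷ p}  (there x∈p) = cong suc (x∈p⇒suc∣p-x∣≡∣p∣ x∈p)
x∈p⇒suc∣p-x∣≡∣p∣ {p = false ∷ p} (there x∈p) = x∈p⇒suc∣p-x∣≡∣p∣ x∈p

x∉p⇒∣p∪⁅x⁆∣≡suc∣p∣ : ∀ {m} {p : Subset m} {x} → x ∉ p → ∣ p ∪ ⁅ x ⁆ ∣ ≡ suc ∣ p ∣
x∉p⇒∣p∪⁅x⁆∣≡suc∣p∣ {p = true ∷ p}  {zero}  x∉p = contradiction here x∉p
x∉p⇒∣p∪⁅x⁆∣≡suc∣p∣ {p = false ∷ p} {zero}  _   = cong (suc ∘ ∣_∣) (∪-identityʳ p)
x∉p⇒∣p∪⁅x⁆∣≡suc∣p∣ {p = true ∷ p}  {suc x} x∉p = cong suc (x∉p⇒∣p∪⁅x⁆∣≡suc∣p∣ (x∉p ∘ there))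
x∉p⇒∣p∪⁅x⁆∣≡suc∣p∣ {p = false ∷ p} {suc x} x∉p = x∉p⇒∣p∪⁅x⁆∣≡suc∣p∣ (x∉p ∘ there)

p⊆q∧∣p∣≡∣q∣⇒p≡q : ∀ {m} {p q : Subset m} → p ⊆ q → ∣ p ∣ ≡ ∣ q ∣ → p ≡ q
p⊆q∧∣p∣≡∣q∣⇒p≡q {p = []}        {[]}        _   _ = refl
p⊆q∧∣p∣≡∣q∣⇒p≡q {p = true ∷ p}  {true ∷ q}  p⊆q eq =
  cong (true ∷_) (p⊆q∧∣p∣≡∣q∣⇒p≡q (drop-∷-⊆ p⊆q) (suc-injective eq))
p⊆q∧∣p∣≡∣q∣⇒p≡q {p = true ∷ p}  {false ∷ q} p⊆q _ with () ← p⊆q here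
p⊆q∧∣p∣≡∣q∣⇒p≡q {p = false ∷ p} {false ∷ q} p⊆q eq =
  cong (false ∷_) (p⊆q∧∣p∣≡∣q∣⇒p≡q (drop-∷-⊆ p⊆q) eq)
p⊆q∧∣p∣≡∣q∣⇒p≡q {p = false ∷ p} {true ∷ q}  p⊆q eq =
  contradiction (p⊆q⇒∣p∣≤∣q∣ (drop-∷-⊆ p⊆q)) (<⇒≱ (≤-reflexive (sym eq)))

module _ {m} {p : Subset m} {x y : Fin m} (x∈p : x ∈ p) (y∉p : y ∉ p) where

  private
    y∉p-x : y ∉ p - x
    y∉p-x = y∉p ∘ p─q⊆p p ⁅ x ⁆

  ∣p-x∪⁅y⁆∣≡∣p∣ : ∣ (p - x) ∪ ⁅ y ⁆ ∣ ≡ ∣ p ∣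
  ∣p-x∪⁅y⁆∣≡∣p∣ = trans (x∉p⇒∣p∪⁅x⁆∣≡suc∣p∣ y∉p-x) (x∈p⇒suc∣p-x∣≡∣p∣ x∈p)

  label-p-x∪⁅y⁆ : ∀ {d} (ψ : Fin m → Z2^ d) → label ψ ((p - x) ∪ ⁅ y ⁆) ≡ (label ψ p ⊕ ψ x) ⊕ ψ y
  label-p-x∪⁅y⁆ ψ = begin
    label ψ ((p - x) ∪ ⁅ y ⁆)
      ≡⟨ cong (label ψ) (trans (x∉p⇒p∪⁅x⁆≡p⊕⁅x⁆ y∉p-x) (cong (_⊕ ⁅ y ⁆) (x∈p⇒p-x≡p⊕⁅x⁆ x∈p))) ⟩
    label ψ ((p ⊕ ⁅ x ⁆) ⊕ ⁅ y ⁆)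
      ≡⟨ label-⊕ ψ (p ⊕ ⁅ x ⁆) ⁅ y ⁆ ⟩
    label ψ (p ⊕ ⁅ x ⁆) ⊕ label ψ ⁅ y ⁆
      ≡⟨ cong₂ _⊕_ (label-⊕ ψ p ⁅ x ⁆) (label-⁅⁆ ψ y) ⟩
    (label ψ p ⊕ label ψ ⁅ x ⁆) ⊕ ψ y
      ≡⟨ cong (λ v → (label ψ p ⊕ v) ⊕ ψ y) (label-⁅⁆ ψ x) ⟩
    (label ψ p ⊕ ψ x) ⊕ ψ y ∎
    where open ≡-Reasoning

module _ {m} {p q : Subset m} {x : Fin m} (∣p∣≡∣q∣ : ∣ p ∣ ≡ ∣ q ∣) (x∈p : x ∈ p) (x∉q : x ∉ q) where

  private
    y∈q∩p⇒y∈p-x : ∀ {y} → y ∈ q → y ∈ p → y ∈ p - x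
    y∈q∩p⇒y∈p-x y∈q y∈p = x∈p∧x≢y⇒x∈p-y y∈p (λ { refl → x∉q y∈q })

  exchange-candidate : ∃ λ y → y ∈ q × y ∉ p
  exchange-candidate with any? (λ y → y ∈? q ×-dec ¬? (y ∈? p))
  ... | yes found = found
  ... | no none = contradiction (p⊆q⇒∣p∣≤∣q∣ q⊆p-x) (<⇒≱ (subst (∣ p - x ∣ <_) ∣p∣≡∣q∣ (x∈p⇒∣p-x∣<∣p∣ x∈p)))
    where
    q⊆p-x : q ⊆ p - x
    q⊆p-x {y} y∈q with y ∈? p
    ... | yes y∈p = y∈q∩p⇒y∈p-x y∈q y∈p
    ... | no  y∉p = contradiction (y , y∈q , y∉p) none

  unique-exchange-candidate : ∀ {y} → y ∉ p → (∀ {z} → z ∈ q → z ∉ p → z ≡ y) → (p - x) ∪ ⁅ y ⁆ ≡ q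
  unique-exchange-candidate {y} y∉p unique =
    sym (p⊆q∧∣p∣≡∣q∣⇒p≡q q⊆p-x∪⁅y⁆ (trans (sym ∣p∣≡∣q∣) (sym (∣p-x∪⁅y⁆∣≡∣p∣ x∈p y∉p))))
    where
    q⊆p-x∪⁅y⁆ : q ⊆ (p - x) ∪ ⁅ y ⁆
    q⊆p-x∪⁅y⁆ {z} z∈q with z ∈? p
    ... | yes z∈p = x∈p∪q⁺ (inj₁ (y∈q∩p⇒y∈p-x z∈q z∈p))
    ... | no  z∉p = x∈p∪q⁺ (inj₂ (subst (_∈ ⁅ y ⁆) (sym (unique z∈q z∉p)) (x∈⁅x⁆ y)))

module SparsePaving {d m} (ψ : Fin m → Z2^ d) (ψ-injective : Injective _≡_ _≡_ ψ) (B* : Subset m) where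

  IsSparseBasis : Subset m → Set
  IsSparseBasis S = ∣ S ∣ ≡ ∣ B* ∣ × (label ψ S ≢ label ψ B* ⊎ S ≡ B*)

  exchange-label-injective : ∀ {p : Subset m} {x y y′} → x ∈ p → y ∉ p → y′ ∉ p →
    label ψ ((p - x) ∪ ⁅ y ⁆) ≡ label ψ ((p - x) ∪ ⁅ y′ ⁆) → y ≡ y′
  exchange-label-injective {p} {x} {y} {y′} x∈p y∉p y′∉p same-label =
    ψ-injective (Z2^.∙-cancelˡ (label ψ p ⊕ ψ x) (ψ y) (ψ y′)
      (trans (sym (label-p-x∪⁅y⁆ x∈p y∉p ψ)) (trans same-label (label-p-x∪⁅y⁆ x∈p y′∉p ψ))))

  -- If exchanging x for y₀ gives the label of B*, exchanging it for any other
  -- candidate y₁ does not; if there is no other candidate, the exchange gives B₂.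
  sparse-exchange : ∀ B₁ B₂ → IsSparseBasis B₁ → IsSparseBasis B₂ →
                    ∀ x → x ∈ B₁ → x ∉ B₂ →
                    ∃ λ y → y ∈ B₂ × y ∉ B₁ × IsSparseBasis ((B₁ - x) ∪ ⁅ y ⁆)
  sparse-exchange B₁ B₂ (∣B₁∣ , _) B₂-basis@(∣B₂∣ , _) x x∈B₁ x∉B₂
    with y₀ , y₀∈B₂ , y₀∉B₁ ← exchange-candidate (trans ∣B₁∣ (sym ∣B₂∣)) x∈B₁ x∉B₂
    with label ψ ((B₁ - x) ∪ ⁅ y₀ ⁆) ≟ᵛ label ψ B*
  ... | no  ≢B* = y₀ , y₀∈B₂ , y₀∉B₁ , trans (∣p-x∪⁅y⁆∣≡∣p∣ x∈B₁ y₀∉B₁) ∣B₁∣ , inj₁ ≢B*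
  ... | yes ≡B* with any? (λ y → y ∈? B₂ ×-dec ¬? (y ∈? B₁) ×-dec ¬? (y ≟ᶠ y₀))
  ...   | yes (y₁ , y₁∈B₂ , y₁∉B₁ , y₁≢y₀) =
    y₁ , y₁∈B₂ , y₁∉B₁ , trans (∣p-x∪⁅y⁆∣≡∣p∣ x∈B₁ y₁∉B₁) ∣B₁∣ ,
    inj₁ (λ ≡B*′ → y₁≢y₀ (exchange-label-injective x∈B₁ y₁∉B₁ y₀∉B₁ (trans ≡B*′ (sym ≡B*))))
  ...   | no none =
    y₀ , y₀∈B₂ , y₀∉B₁ ,
    subst IsSparseBasis (sym (unique-exchange-candidate (trans ∣B₁∣ (sym ∣B₂∣)) x∈B₁ x∉B₂ y₀∉B₁ only-y₀)) B₂-basis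
    where
    only-y₀ : ∀ {z} → z ∈ B₂ → z ∉ B₁ → z ≡ y₀
    only-y₀ {z} z∈B₂ z∉B₁ = decidable-stable (z ≟ᶠ y₀) (λ z≢y₀ → none (z , z∈B₂ , z∉B₁ , z≢y₀))

  sparsePaving : Matroid m
  sparsePaving = record
    { IsBasis  = IsSparseBasis
    ; nonempty = B* , refl , inj₂ refl
    ; exchange = sparse-exchange
    }

  sparse-basis-label : ∀ {S} → IsSparseBasis S → label ψ S ≡ label ψ B* → S ≡ B*
  sparse-basis-label (_ , inj₁ ≢B*) ≡B* = contradiction ≡B* ≢B*
  sparse-basis-label (_ , inj₂ S≡B*) _  = S≡B*

¬IsClose-by-far-bases : ∀ {d m k} (ψ : Fin m → Z2^ d) → Injective _≡_ _≡_ ψ →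
  (B B* : Subset m) → ∣ B ∣ ≡ ∣ B* ∣ → label ψ B ≢ label ψ B* → k < ∣ B ─ B* ∣ →
  ¬ IsClose d k
¬IsClose-by-far-bases {k = k} ψ ψ-injective B B* ∣B∣≡∣B*∣ labels-differ far close =
  let B′ , B′-basis , B′-label , B′-near =
        close _ sparsePaving ψ (label ψ B*) B (∣B∣≡∣B*∣ , inj₁ labels-differ) (B* , (refl , inj₂ refl) , refl)
  in <⇒≱ far (subst (λ S → ∣ B ─ S ∣ ≤ k) (sparse-basis-label B′-basis B′-label) B′-near)
  where open SparsePaving ψ ψ-injective B*

IsClose-mono : ∀ {d k k′} → k ≤ k′ → IsClose d k → IsClose d k′
IsClose-mono k≤k′ close m M ψ g B B-basis reachable =
  let B* , B*-basis , B*-label , near = close m M ψ g B B-basis reachable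
  in B* , B*-basis , B*-label , ≤-trans near k≤k′

module Bits where
  open Inverse 2↔Bool using (to; from; strictlyInverseˡ; strictlyInverseʳ)

  fromBits : ∀ {n} → Vec Bool n → Fin (2 ^ n)
  fromBits []      = zero
  fromBits (b ∷ v) = combine (from b) (fromBits v)

  toBits : ∀ n → Fin (2 ^ n) → Vec Bool n
  toBits zero    _ = []
  toBits (suc n) i = to (proj₁ (remQuot {2} (2 ^ n) i)) ∷ toBits n (proj₂ (remQuot {2} (2 ^ n) i))

  toBits-fromBits : ∀ {n} (v : Vec Bool n) → toBits n (fromBits v) ≡ v
  toBits-fromBits []               = refl
  toBits-fromBits {suc n} (b ∷ v) =
    trans (cong (λ (q , r) → to q ∷ toBits n r) (remQuot-combine {2} {2 ^ n} (from b) (fromBits v)))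
          (cong₂ _∷_ (strictlyInverseˡ b) (toBits-fromBits v))

  fromBits-toBits : ∀ n (i : Fin (2 ^ n)) → fromBits (toBits n i) ≡ i
  fromBits-toBits zero    zero = refl
  fromBits-toBits (suc n) i    =
    trans (cong₂ combine (strictlyInverseʳ (proj₁ (remQuot {2} (2 ^ n) i)))
                         (fromBits-toBits n (proj₂ (remQuot {2} (2 ^ n) i))))
          (combine-remQuot {2} (2 ^ n) i)

  fromBits-injective : ∀ {n} → Injective _≡_ _≡_ (fromBits {n})
  fromBits-injective {n} {u} {v} eq =
    trans (sym (toBits-fromBits u)) (trans (cong (toBits n) eq) (toBits-fromBits v))

  toBits-injective : ∀ n → Injective _≡_ _≡_ (toBits n)
  toBits-injective n {i} {j} eq =
    trans (sym (fromBits-toBits n i)) (trans (cong fromBits eq) (fromBits-toBits n j))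

≢⇒Nonempty[⊕] : ∀ {m} {S T : Subset m} → S ≢ T → Nonempty (S ⊕ T)
≢⇒Nonempty[⊕] {S = S} {T} S≢T with nonempty? (S ⊕ T)
... | yes nonempty = nonempty
... | no  empty    = contradiction (Z2^.inverseˡ-unique S T (Empty-unique empty)) S≢T

Z2^-zeroSum : ∀ d → ZeroSumProperty d (suc d)
Z2^-zeroSum d s =
  let i , j , i<j , same-code = pigeonhole (^-monoʳ-< 2 (s≤s (s≤s z≤n)) (n<1+n d))
                                           (fromBits ∘ label s ∘ toBits (suc d))
      S = toBits (suc d) i
      T = toBits (suc d) j
  in S ⊕ T , ≢⇒Nonempty[⊕] (<⇒≢ i<j ∘ toBits-injective (suc d)) , (begin
       label s (S ⊕ T)         ≡⟨ label-⊕ s S T ⟩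
       label s S ⊕ label s T   ≡⟨ cong (_⊕ label s T) (fromBits-injective same-code) ⟩
       label s T ⊕ label s T   ≡⟨ ⊕-self (label s T) ⟩
       0g                      ∎)
  where
  open Bits
  open ≡-Reasoning

groundSize : ℕ → ℕ
groundSize zero    = 10
groundSize (suc n) = 2 + groundSize n

base : Fin 10 → Z2^ 4
base = lookup ( (false ∷ false ∷ false ∷ false ∷ [])
              ∷ (true  ∷ false ∷ false ∷ false ∷ [])
              ∷ (false ∷ true  ∷ false ∷ false ∷ [])
              ∷ (false ∷ false ∷ true  ∷ false ∷ [])
              ∷ (false ∷ false ∷ false ∷ true  ∷ [])
              ∷ (true  ∷ true  ∷ false ∷ false ∷ [])
              ∷ (true  ∷ false ∷ true  ∷ false ∷ [])
              ∷ (true  ∷ false ∷ false ∷ true  ∷ [])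
              ∷ (false ∷ true  ∷ true  ∷ false ∷ [])
              ∷ (false ∷ true  ∷ false ∷ true  ∷ [])
              ∷ [])

base-injective : Injective _≡_ _≡_ base
base-injective {x} {y} =
  toWitness {a? = all? λ i → all? λ j → (base i ≟ᵛ base j) →-dec (i ≟ᶠ j)} _ x y

-- gap n is the label difference of the two halves; twist n is chosen so that
-- false ∷ (twist n ⊕ gap n) ≡ gap (suc n).
gap twist : ∀ n → Z2^ (4 + n)
gap   n = false ∷ false ∷ true ∷ true ∷ 0g
twist n = false ∷ true ∷ false ∷ true ∷ 0g

labelling : ∀ n → Fin (groundSize n) → Z2^ (4 + n)
labelling zero                  = base
labelling (suc n) zero          = true ∷ 0g
labelling (suc n) (suc zero)    = true ∷ twist n
labelling (suc n) (suc (suc i)) = false ∷ labelling n i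

labelling-injective : ∀ n → Injective _≡_ _≡_ (labelling n)
labelling-injective zero = base-injective
labelling-injective (suc n) {zero}          {zero}          _  = refl
labelling-injective (suc n) {suc zero}      {suc zero}      _  = refl
labelling-injective (suc n) {suc (suc x)}   {suc (suc y)}   eq =
  cong (λ i → suc (suc i)) (labelling-injective n (∷-injectiveʳ eq))
labelling-injective (suc n) {zero}          {suc zero}      ()
labelling-injective (suc n) {zero}          {suc (suc _)}   ()
labelling-injective (suc n) {suc zero}      {zero}          ()
labelling-injective (suc n) {suc zero}      {suc (suc _)}   ()
labelling-injective (suc n) {suc (suc _)}   {zero}          ()
labelling-injective (suc n) {suc (suc _)}   {suc zero}      ()

start target : ∀ n → Subset (groundSize n)
start  zero    = true ∷ true ∷ true ∷ true ∷ true ∷ ⊥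
start  (suc n) = true ∷ false ∷ start n
target zero    = false ∷ false ∷ false ∷ false ∷ false ∷ true ∷ true ∷ true ∷ true ∷ true ∷ []
target (suc n) = false ∷ true ∷ target n

∣start∣≡∣target∣ : ∀ n → ∣ start n ∣ ≡ ∣ target n ∣
∣start∣≡∣target∣ zero    = refl
∣start∣≡∣target∣ (suc n) = cong suc (∣start∣≡∣target∣ n)

∣start─target∣≡5+n : ∀ n → ∣ start n ─ target n ∣ ≡ 5 + n
∣start─target∣≡5+n zero    = refl
∣start─target∣≡5+n (suc n) = cong suc (∣start─target∣≡5+n n)

label-start⊕label-target : ∀ n →
  label (labelling n) (start n) ⊕ label (labelling n) (target n) ≡ gap n
label-start⊕label-target zero    = refl
label-start⊕label-target (suc n) = begin
  label (labelling (suc n)) (start (suc n)) ⊕ label (labelling (suc n)) (target (suc n))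
    ≡⟨ cong₂ _⊕_ label-start label-target ⟩
  false ∷ (L-start ⊕ (twist n ⊕ L-target))
    ≡⟨ cong (false ∷_) (Z2^.x∙yz≈y∙xz L-start (twist n) L-target) ⟩
  false ∷ (twist n ⊕ (L-start ⊕ L-target))
    ≡⟨ cong (λ v → false ∷ (twist n ⊕ v)) (label-start⊕label-target n) ⟩
  false ∷ (twist n ⊕ gap n)
    ≡⟨ cong (λ v → false ∷ false ∷ true ∷ true ∷ false ∷ v) (⊕-self 0g) ⟩
  gap (suc n) ∎
  where
  open ≡-Reasoning
  L-start L-target : Z2^ (4 + n)
  L-start  = label (labelling n) (start n)
  L-target = label (labelling n) (target n)
  label-start : label (labelling (suc n)) (start (suc n)) ≡ true ∷ L-start
  label-start = trans (cong (λ v → (true ∷ 0g) ⊕ (0g ⊕ v)) (label-false∷ (labelling n) (start n)))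
                      (cong (true ∷_) (trans (⊕-identityˡ _) (⊕-identityˡ _)))
  label-target : label (labelling (suc n)) (target (suc n)) ≡ true ∷ (twist n ⊕ L-target)
  label-target = trans (cong (λ v → 0g ⊕ ((true ∷ twist n) ⊕ v)) (label-false∷ (labelling n) (target n)))
                       (cong (true ∷_) (⊕-identityˡ _))

start-target-labels-differ : ∀ n → label (labelling n) (start n) ≢ label (labelling n) (target n)
start-target-labels-differ n same with () ←
  trans (sym (label-start⊕label-target n)) (trans (cong (_⊕ label (labelling n) (target n)) same) (⊕-self _))

mainTheorem19 : (d : ℕ) → 4 ≤ d → (D : ℕ) → IsDavenportConstant d D →
    ¬ IsClose d (D ∸ 1)
mainTheorem19 _ (s≤s (s≤s (s≤s (s≤s (z≤n {n}))))) D (_ , D-minimal) =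
  ¬IsClose-by-far-bases (labelling n) (labelling-injective n) (start n) (target n)
    (∣start∣≡∣target∣ n) (start-target-labels-differ n) (≤-reflexive (sym (∣start─target∣≡5+n n)))
  ∘ IsClose-mono (∸-monoˡ-≤ 1 (D-minimal (5 + n) (Z2^-zeroSum (4 + n))))
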